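{- Fix an integer $k \ge 1$. Then \[\lim_{n\to\infty} c_d(S(n,kn)) = \frac{k^3}{(2k+1)^2}.\]
   Context: The complete split graph $S(n,m) = K_{n+m} - K_m$ consists of a clique on $n$ vertices and an independent set of $m$ vertices, with every clique vertex adjacent to all other vertices. For $v\in\mathbb{R}^N_+$ with mean $\mu$ and (population) standard deviation $\sigma$, $\sigma^2=\frac1N\sum_i(v_i-\mu)^2$, set $c_v=(\sigma/\mu)^2$; $c_d(G)=c_d$ where $d$ is the degree vector of $G$. -}

module Defs where

open import Data.Nat as ℕ using (ℕ; zero; suc; _<?_)
open import Data.Fin using (Fin; toℕ)
open import Data.Fin.Properties using (_≟_)
open import Data.List using (List; length; filter; allFin; map; sum; foldr)
open import Data.Integer using (+_)
open import Data.Rational as ℚ using (ℚ; 0ℚ; _/_; _-_; _*_; _+_; _÷_; ≢-nonZero)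
open import Data.Rational.Properties using () renaming (_≟_ to _≟ℚ_)
open import Data.Sum using (_⊎_)
open import Data.Product using (_×_)
open import Relation.Nullary using (¬_; yes; no; Dec)
open import Relation.Nullary.Decidable using (_×-dec_; _⊎-dec_; ¬?)
open import Relation.Binary.PropositionalEquality using (_≡_)

-- Complete split graph S(n,m) = K_{n+m} - K_m on vertex set Fin (n + m).

InClique : (n m : ℕ) → Fin (n ℕ.+ m) → Set
InClique n m i = toℕ i ℕ.< n

SplitAdj : (n m : ℕ) → Fin (n ℕ.+ m) → Fin (n ℕ.+ m) → Set
SplitAdj n m i j = (¬ (i ≡ j)) × (InClique n m i ⊎ InClique n m j)

splitAdj? : (n m : ℕ) → (i j : Fin (n ℕ.+ m)) → Dec (SplitAdj n m i j)
splitAdj? n m i j = ¬? (i ≟ j) ×-dec ((toℕ i <? n) ⊎-dec (toℕ j <? n))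

splitDegree : (n m : ℕ) → Fin (n ℕ.+ m) → ℕ
splitDegree n m i = length (filter (splitAdj? n m i) (allFin (n ℕ.+ m)))

splitDegrees : (n m : ℕ) → List ℕ
splitDegrees n m = map (splitDegree n m) (allFin (n ℕ.+ m))

-- total division on ℚ: p / q, with the (irrelevant) convention p / 0 = 0
_÷'_ : ℚ → ℚ → ℚ
p ÷' q with q ≟ℚ 0ℚ
... | yes _  = 0ℚ
... | no q≢0 = _÷_ p q {{≢-nonZero q≢0}}

ℕtoℚ : ℕ → ℚ
ℕtoℚ k = (+ k) / 1

sumℚ : List ℚ → ℚ
sumℚ = foldr _+_ 0ℚ

mean : List ℚ → ℚ
mean v = sumℚ v ÷' ℕtoℚ (length v)

variance : List ℚ → ℚ
variance v = sumℚ (map (λ x → (x - mean v) * (x - mean v)) v) ÷' ℕtoℚ (length v)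

cv : List ℚ → ℚ
cv v = variance v ÷' (mean v * mean v)

cdSplit : (n m : ℕ) → ℚ
cdSplit n m = cv (map ℕtoℚ (splitDegrees n m))

{-# OPTIONS --safe #-}
module Submission where

-- The n clique vertices of S(n, kn) have degree n − 1 + kn and the kn others have degree n,
-- so the degree vector is two-valued. A vector with p entries x and q entries y has
-- c_v (p x + q y)² = p q (x − y)², which here gives c_d = k a² / b² with a = kn − 1 and
-- b = (2k+1)n − 1. Since k b = (2k+1) a + (k+1), the distance from c_d to k³/(2k+1)² is
-- k(k+1)(kb + (2k+1)a) / (b²(2k+1)²) ≤ 2k²(k+1) / (b(2k+1)²), which tends to 0.

open import Defs
open import Data.Nat as ℕ using (ℕ; zero; suc; _≤_; _^_; z≤n; s≤s)
import Data.Nat.Properties as ℕP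
open import Data.Nat.Tactic.RingSolver using (solve-∀)
open import Data.Fin using (Fin; toℕ) renaming (zero to fzero; suc to fsuc)
open import Data.Fin.Properties using (_≟_) renaming (suc-injective to fsuc-injective)
open import Data.Integer as ℤ using (+_; +[1+_]; -[1+_])
import Data.Integer.Properties as ℤP
open import Data.Rational as ℚ using (ℚ; 0ℚ; 1ℚ; _+_; _*_; _-_; -_; 1/_; _/_; mkℚ; toℚᵘ; ∣_∣; _<_)
import Data.Rational.Properties as ℚP
open import Data.Rational.Unnormalised as ℚᵘ using (mkℚᵘ; *≡*; *≤*; *<*)
import Data.Rational.Unnormalised.Properties as ℚᵘP
open import Data.Rational.Solver using (module +-*-Solver)
open import Data.List using (List; _∷_; []; _++_; length; filter; allFin; map; replicate; tabulate)
open import Data.List.Properties using (filter-≐; map-tabulate; length-++; length-replicate; map-++; map-replicate)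
open import Data.Product using (∃-syntax; _,_; proj₁)
open import Data.Sum using (inj₁; inj₂)
open import Function using (_∘_; id)
open import Level using (0ℓ)
open import Relation.Binary.PropositionalEquality
open import Relation.Nullary using (¬_; yes; no; contradiction)
open import Relation.Nullary.Decidable using (¬?)
open import Relation.Unary using (Pred; Decidable)

open +-*-Solver using (solve; _:+_; _:*_; _:-_; :-_; _:=_)

countFin : ∀ {N} {P : Pred (Fin N) 0ℓ} → Decidable P → ℕ
countFin {N} P? = length (filter P? (allFin N))

length-filter-tabulate : ∀ {A : Set} {N} {P : Pred A 0ℓ} (P? : Decidable P) (f : Fin N → A) →
  length (filter P? (tabulate f)) ≡ countFin (P? ∘ f)
length-filter-tabulate {N = zero} P? f = refl
length-filter-tabulate {N = suc N} P? f with P? (f fzero)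
... | yes _ = cong suc (trans (length-filter-tabulate P? (f ∘ fsuc))
                              (sym (length-filter-tabulate (P? ∘ f) fsuc)))
... | no _ = trans (length-filter-tabulate P? (f ∘ fsuc))
                   (sym (length-filter-tabulate (P? ∘ f) fsuc))

module _ {N} {P : Pred (Fin (suc N)) 0ℓ} (P? : Decidable P) where

  countFin-accept : P fzero → countFin P? ≡ suc (countFin (P? ∘ fsuc))
  countFin-accept p with P? fzero
  ... | yes _ = cong suc (length-filter-tabulate P? fsuc)
  ... | no ¬p = contradiction p ¬p

  countFin-reject : ¬ P fzero → countFin P? ≡ countFin (P? ∘ fsuc)
  countFin-reject ¬p with P? fzero
  ... | yes p = contradiction p ¬p
  ... | no _ = length-filter-tabulate P? fsuc

countFin-cong : ∀ {N} {P Q : Pred (Fin N) 0ℓ} (P? : Decidable P) (Q? : Decidable Q) →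
  (∀ {j} → P j → Q j) → (∀ {j} → Q j → P j) → countFin P? ≡ countFin Q?
countFin-cong {N} P? Q? P⇒Q Q⇒P = cong length (filter-≐ P? Q? (P⇒Q , Q⇒P) (allFin N))

countFin-all : ∀ {N} {P : Pred (Fin N) 0ℓ} (P? : Decidable P) → (∀ j → P j) → countFin P? ≡ N
countFin-all {zero} P? all = refl
countFin-all {suc N} P? all =
  trans (countFin-accept P? (all fzero)) (cong suc (countFin-all (P? ∘ fsuc) (all ∘ fsuc)))

countFin-none : ∀ {N} {P : Pred (Fin N) 0ℓ} (P? : Decidable P) → (∀ j → ¬ P j) → countFin P? ≡ 0
countFin-none {zero} P? none = refl
countFin-none {suc N} P? none =
  trans (countFin-reject P? (none fzero)) (countFin-none (P? ∘ fsuc) (none ∘ fsuc))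

countFin-≢ : ∀ {N} (i : Fin (suc N)) → countFin (λ j → ¬? (i ≟ j)) ≡ N
countFin-≢ {N} fzero =
  trans (countFin-reject (λ (j : Fin (suc N)) → ¬? (fzero ≟ j)) (λ i≢i → i≢i refl))
        (countFin-all (λ j → ¬? (fzero ≟ fsuc j)) (λ j ()))
countFin-≢ {suc N} (fsuc i) =
  trans (countFin-accept (λ (j : Fin (suc (suc N))) → ¬? (fsuc i ≟ j)) (λ ()))
        (cong suc (trans (countFin-cong (λ j → ¬? (fsuc i ≟ fsuc j)) (λ j → ¬? (i ≟ j))
                                        (λ i≢j i≡j → i≢j (cong fsuc i≡j))
                                        (λ i≢j i≡j → i≢j (fsuc-injective i≡j)))
                         (countFin-≢ i)))

countFin-< : ∀ n m → countFin {n ℕ.+ m} (λ j → toℕ j ℕ.<? n) ≡ n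
countFin-< zero m = countFin-none (λ (j : Fin m) → toℕ j ℕ.<? 0) (λ j ())
countFin-< (suc n) m =
  trans (countFin-accept (λ (j : Fin (suc n ℕ.+ m)) → toℕ j ℕ.<? suc n) (s≤s z≤n))
        (cong suc (trans (countFin-cong (λ (j : Fin (n ℕ.+ m)) → toℕ (fsuc j) ℕ.<? suc n)
                                        (λ j → toℕ j ℕ.<? n)
                                        ℕP.≤-pred s≤s)
                         (countFin-< n m)))

splitDegree-clique : ∀ n m (i : Fin (suc n ℕ.+ m)) → InClique (suc n) m i →
  splitDegree (suc n) m i ≡ n ℕ.+ m
splitDegree-clique n m i i∈K =
  trans (countFin-cong (splitAdj? (suc n) m i) (λ j → ¬? (i ≟ j)) proj₁ (λ i≢j → i≢j , inj₁ i∈K))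
        (countFin-≢ i)

splitDegree-independent : ∀ n m (i : Fin (n ℕ.+ m)) → ¬ InClique n m i →
  splitDegree n m i ≡ n
splitDegree-independent n m i i∉K =
  trans (countFin-cong (splitAdj? n m i) (λ j → toℕ j ℕ.<? n)
          (λ { (_ , inj₁ i∈K) → contradiction i∈K i∉K ; (_ , inj₂ j∈K) → j∈K })
          (λ {j} j∈K → (λ i≡j → i∉K (subst (InClique n m) (sym i≡j) j∈K)) , inj₂ j∈K))
        (countFin-< n m)

tabulate-twoValued : ∀ {A : Set} n m (f : Fin (n ℕ.+ m) → A) x y →
  (∀ i → toℕ i ℕ.< n → f i ≡ x) → (∀ i → ¬ toℕ i ℕ.< n → f i ≡ y) →
  tabulate f ≡ replicate n x ++ replicate m y
tabulate-twoValued zero zero f x y fx fy = refl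
tabulate-twoValued zero (suc m) f x y fx fy =
  cong₂ _∷_ (fy fzero (λ ())) (tabulate-twoValued zero m (f ∘ fsuc) x y (λ i ()) (λ i _ → fy (fsuc i) (λ ())))
tabulate-twoValued (suc n) m f x y fx fy =
  cong₂ _∷_ (fx fzero (s≤s z≤n))
            (tabulate-twoValued n m (f ∘ fsuc) x y (λ i i<n → fx (fsuc i) (s≤s i<n))
                                                   (λ i i≮n → fy (fsuc i) (i≮n ∘ ℕP.≤-pred)))

splitDegrees-twoValued : ∀ n m → splitDegrees (suc n) m ≡ replicate (suc n) (n ℕ.+ m) ++ replicate m (suc n)
splitDegrees-twoValued n m =
  trans (map-tabulate id (splitDegree (suc n) m))
        (tabulate-twoValued (suc n) m (splitDegree (suc n) m) (n ℕ.+ m) (suc n)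
          (splitDegree-clique n m) (splitDegree-independent (suc n) m))

toℚᵘ-ℕtoℚ : ∀ m → toℚᵘ (ℕtoℚ m) ℚᵘ.≃ mkℚᵘ (+ m) 0
toℚᵘ-ℕtoℚ m = ℚP.toℚᵘ-fromℚᵘ (mkℚᵘ (+ m) 0)

ℕtoℚ-+ : ∀ m n → ℕtoℚ (m ℕ.+ n) ≡ ℕtoℚ m + ℕtoℚ n
ℕtoℚ-+ m n = ℚP.toℚᵘ-injective (begin
  toℚᵘ (ℕtoℚ (m ℕ.+ n))             ≈⟨ toℚᵘ-ℕtoℚ (m ℕ.+ n) ⟩
  mkℚᵘ (+ (m ℕ.+ n)) 0               ≈⟨ *≡* (cong (ℤ._* + 1) numerator≡) ⟩
  mkℚᵘ (+ m) 0 ℚᵘ.+ mkℚᵘ (+ n) 0      ≈⟨ ℚᵘP.+-cong (toℚᵘ-ℕtoℚ m) (toℚᵘ-ℕtoℚ n) ⟨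
  toℚᵘ (ℕtoℚ m) ℚᵘ.+ toℚᵘ (ℕtoℚ n)  ≈⟨ ℚP.toℚᵘ-homo-+ (ℕtoℚ m) (ℕtoℚ n) ⟨
  toℚᵘ (ℕtoℚ m + ℕtoℚ n)             ∎)
  where
  open ℚᵘP.≃-Reasoning
  numerator≡ : + (m ℕ.+ n) ≡ + m ℤ.* + 1 ℤ.+ + n ℤ.* + 1
  numerator≡ = trans (ℤP.pos-+ m n) (sym (cong₂ ℤ._+_ (ℤP.*-identityʳ (+ m)) (ℤP.*-identityʳ (+ n))))

ℕtoℚ-* : ∀ m n → ℕtoℚ (m ℕ.* n) ≡ ℕtoℚ m * ℕtoℚ n
ℕtoℚ-* m n = ℚP.toℚᵘ-injective (begin
  toℚᵘ (ℕtoℚ (m ℕ.* n))             ≈⟨ toℚᵘ-ℕtoℚ (m ℕ.* n) ⟩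
  mkℚᵘ (+ (m ℕ.* n)) 0               ≈⟨ *≡* (cong (ℤ._* + 1) (ℤP.pos-* m n)) ⟩
  mkℚᵘ (+ m) 0 ℚᵘ.* mkℚᵘ (+ n) 0      ≈⟨ ℚᵘP.*-cong (toℚᵘ-ℕtoℚ m) (toℚᵘ-ℕtoℚ n) ⟨
  toℚᵘ (ℕtoℚ m) ℚᵘ.* toℚᵘ (ℕtoℚ n)  ≈⟨ ℚP.toℚᵘ-homo-* (ℕtoℚ m) (ℕtoℚ n) ⟨
  toℚᵘ (ℕtoℚ m * ℕtoℚ n)             ∎)
  where open ℚᵘP.≃-Reasoning

ℕtoℚ-mono-≤ : ∀ {m n} → m ℕ.≤ n → ℕtoℚ m ℚ.≤ ℕtoℚ n
ℕtoℚ-mono-≤ {m} {n} m≤n = ℚP.toℚᵘ-cancel-≤ (begin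
  toℚᵘ (ℕtoℚ m)  ≃⟨ toℚᵘ-ℕtoℚ m ⟩
  mkℚᵘ (+ m) 0    ≤⟨ *≤* (ℤP.*-monoʳ-≤-nonNeg (+ 1) (ℤ.+≤+ m≤n)) ⟩
  mkℚᵘ (+ n) 0    ≃⟨ toℚᵘ-ℕtoℚ n ⟨
  toℚᵘ (ℕtoℚ n)  ∎)
  where open ℚᵘP.≤-Reasoning

ℕtoℚ-pos : ∀ m .{{_ : ℕ.NonZero m}} → ℚ.Positive (ℕtoℚ m)
ℕtoℚ-pos m = ℚP.normalize-pos m 1

ℕtoℚ-≢0 : ∀ m .{{_ : ℕ.NonZero m}} → ¬ ℕtoℚ m ≡ 0ℚ
ℕtoℚ-≢0 m eq = ℚP.<-irrefl (sym eq) (ℚP.positive⁻¹ _ {{ℕtoℚ-pos m}})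

p÷'q*q≡p : ∀ p q → ¬ q ≡ 0ℚ → (p ÷' q) * q ≡ p
p÷'q*q≡p p q q≢0 with q ℚP.≟ 0ℚ
... | yes q≡0 = contradiction q≡0 q≢0
... | no q≢0 = begin
  p * 1/ q * q    ≡⟨ ℚP.*-assoc p (1/ q) q ⟩
  p * (1/ q * q)  ≡⟨ cong (p *_) (ℚP.*-inverseˡ q) ⟩
  p * 1ℚ          ≡⟨ ℚP.*-identityʳ p ⟩
  p               ∎
  where
  open ≡-Reasoning
  instance _ = ℚ.≢-nonZero q≢0

*-≢0 : ∀ {p q} → ¬ p ≡ 0ℚ → ¬ q ≡ 0ℚ → ¬ p * q ≡ 0ℚ
*-≢0 {p} {q} p≢0 q≢0 pq≡0 = q≢0 (begin
  q                ≡⟨ sym (ℚP.*-identityˡ q) ⟩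
  1ℚ * q           ≡⟨ cong (_* q) (sym (ℚP.*-inverseˡ p)) ⟩
  1/ p * p * q     ≡⟨ ℚP.*-assoc (1/ p) p q ⟩
  1/ p * (p * q)   ≡⟨ cong (1/ p *_) pq≡0 ⟩
  1/ p * 0ℚ        ≡⟨ ℚP.*-zeroʳ (1/ p) ⟩
  0ℚ               ∎)
  where
  open ≡-Reasoning
  instance _ = ℚ.≢-nonZero p≢0

sumℚ-++ : ∀ xs ys → sumℚ (xs ++ ys) ≡ sumℚ xs + sumℚ ys
sumℚ-++ [] ys = sym (ℚP.+-identityˡ (sumℚ ys))
sumℚ-++ (x ∷ xs) ys = trans (cong (_+_ x) (sumℚ-++ xs ys)) (sym (ℚP.+-assoc x (sumℚ xs) (sumℚ ys)))

sumℚ-replicate : ∀ n x → sumℚ (replicate n x) ≡ ℕtoℚ n * x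
sumℚ-replicate zero x = sym (ℚP.*-zeroˡ x)
sumℚ-replicate (suc n) x = begin
  x + sumℚ (replicate n x)   ≡⟨ cong (_+_ x) (sumℚ-replicate n x) ⟩
  x + ℕtoℚ n * x             ≡⟨ cong (_+ ℕtoℚ n * x) (sym (ℚP.*-identityˡ x)) ⟩
  1ℚ * x + ℕtoℚ n * x        ≡⟨ sym (ℚP.*-distribʳ-+ x 1ℚ (ℕtoℚ n)) ⟩
  (1ℚ + ℕtoℚ n) * x          ≡⟨ cong (_* x) (sym (ℕtoℚ-+ 1 n)) ⟩
  ℕtoℚ (suc n) * x           ∎
  where open ≡-Reasoning

sumℚ≢0⇒length≢0 : ∀ xs → ¬ sumℚ xs ≡ 0ℚ → ¬ ℕtoℚ (length xs) ≡ 0ℚ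
sumℚ≢0⇒length≢0 [] sum≢0 = contradiction refl sum≢0
sumℚ≢0⇒length≢0 (_ ∷ xs) _ = ℕtoℚ-≢0 (suc (length xs))

module _ (v : List ℚ) (sum≢0 : ¬ sumℚ v ≡ 0ℚ) where

  private
    N≢0 : ¬ ℕtoℚ (length v) ≡ 0ℚ
    N≢0 = sumℚ≢0⇒length≢0 v sum≢0

  mean*length : mean v * ℕtoℚ (length v) ≡ sumℚ v
  mean*length = p÷'q*q≡p (sumℚ v) (ℕtoℚ (length v)) N≢0

  variance*length : variance v * ℕtoℚ (length v) ≡ sumℚ (map (λ x → (x - mean v) * (x - mean v)) v)
  variance*length = p÷'q*q≡p (sumℚ (map (λ x → (x - mean v) * (x - mean v)) v)) (ℕtoℚ (length v)) N≢0

  mean≢0 : ¬ mean v ≡ 0ℚ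
  mean≢0 μ≡0 = sum≢0 (begin
    sumℚ v                        ≡⟨ sym mean*length ⟩
    mean v * ℕtoℚ (length v)      ≡⟨ cong (_* ℕtoℚ (length v)) μ≡0 ⟩
    0ℚ * ℕtoℚ (length v)          ≡⟨ ℚP.*-zeroˡ (ℕtoℚ (length v)) ⟩
    0ℚ                            ∎)
    where open ≡-Reasoning

  cv*mean² : cv v * (mean v * mean v) ≡ variance v
  cv*mean² = p÷'q*q≡p (variance v) (mean v * mean v) (*-≢0 mean≢0 mean≢0)

cv-twoValued : ∀ p q x y → ¬ ℕtoℚ p * x + ℕtoℚ q * y ≡ 0ℚ →
  cv (replicate p x ++ replicate q y) * ((ℕtoℚ p * x + ℕtoℚ q * y) * (ℕtoℚ p * x + ℕtoℚ q * y))
    ≡ ℕtoℚ p * ℕtoℚ q * ((x - y) * (x - y))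
cv-twoValued p q x y S≢0 = begin
  cv v * (S * S)                                           ≡⟨ cong (λ s → cv v * (s * s)) (sym μN≡S) ⟩
  cv v * ((μ * N) * (μ * N))                               ≡⟨ regroup (cv v) μ N ⟩
  cv v * (μ * μ) * N * N                                   ≡⟨ cong (λ w → w * N * N) (cv*mean² v sum≢0) ⟩
  variance v * N * N                                       ≡⟨ cong (_* N) (variance*length v sum≢0) ⟩
  sumℚ (map sq v) * N                                      ≡⟨ cong₂ _*_ sumSq N≡P+Q ⟩
  (P * sq x + Q * sq y) * (P + Q)                          ≡⟨ twoValued-identity P Q x y μ ⟩
  P * Q * ((x - y) * (x - y)) + (μ * (P + Q) - S) * (μ * (P + Q) - S)
                                                           ≡⟨ cong (λ e → P * Q * ((x - y) * (x - y)) + e * e) e≡0 ⟩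
  P * Q * ((x - y) * (x - y)) + 0ℚ * 0ℚ                    ≡⟨ ℚP.+-identityʳ (P * Q * ((x - y) * (x - y))) ⟩
  P * Q * ((x - y) * (x - y))                              ∎
  where
  open ≡-Reasoning
  v : List ℚ
  v = replicate p x ++ replicate q y
  P Q S N μ : ℚ
  P = ℕtoℚ p
  Q = ℕtoℚ q
  S = P * x + Q * y
  N = ℕtoℚ (length v)
  μ = mean v
  sq : ℚ → ℚ
  sq z = (z - μ) * (z - μ)

  sum≡S : sumℚ v ≡ S
  sum≡S = trans (sumℚ-++ (replicate p x) (replicate q y))
                (cong₂ _+_ (sumℚ-replicate p x) (sumℚ-replicate q y))

  sum≢0 : ¬ sumℚ v ≡ 0ℚ
  sum≢0 sum≡0 = S≢0 (trans (sym sum≡S) sum≡0)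

  N≡P+Q : N ≡ P + Q
  N≡P+Q = trans (cong ℕtoℚ (trans (length-++ (replicate p x))
                                  (cong₂ ℕ._+_ (length-replicate p) (length-replicate q))))
                (ℕtoℚ-+ p q)

  μN≡S : μ * N ≡ S
  μN≡S = trans (mean*length v sum≢0) sum≡S

  sumSq : sumℚ (map sq v) ≡ P * sq x + Q * sq y
  sumSq = begin
    sumℚ (map sq v)                                           ≡⟨ cong sumℚ (map-++ sq (replicate p x) (replicate q y)) ⟩
    sumℚ (map sq (replicate p x) ++ map sq (replicate q y))   ≡⟨ sumℚ-++ (map sq (replicate p x)) _ ⟩
    sumℚ (map sq (replicate p x)) + sumℚ (map sq (replicate q y))
                            ≡⟨ cong₂ (λ l r → sumℚ l + sumℚ r) (map-replicate sq p x) (map-replicate sq q y) ⟩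
    sumℚ (replicate p (sq x)) + sumℚ (replicate q (sq y))   ≡⟨ cong₂ _+_ (sumℚ-replicate p (sq x)) (sumℚ-replicate q (sq y)) ⟩
    P * sq x + Q * sq y                                       ∎

  e≡0 : μ * (P + Q) - S ≡ 0ℚ
  e≡0 = trans (cong (λ w → μ * w - S) (sym N≡P+Q)) (trans (cong (_- S) μN≡S) (ℚP.+-inverseʳ S))

  regroup : ∀ c m n → c * ((m * n) * (m * n)) ≡ c * (m * m) * n * n
  regroup = solve 3 (λ c m n → c :* ((m :* n) :* (m :* n)) := c :* (m :* m) :* n :* n) refl

  -- With e = μ(P+Q) − S the deviations are (x − μ)(P+Q) = Q(x − y) − e and (y − μ)(P+Q) = −P(x − y) − e.
  twoValued-identity : ∀ P Q x y μ →
    (P * ((x - μ) * (x - μ)) + Q * ((y - μ) * (y - μ))) * (P + Q)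
      ≡ P * Q * ((x - y) * (x - y)) + (μ * (P + Q) - (P * x + Q * y)) * (μ * (P + Q) - (P * x + Q * y))
  twoValued-identity = solve 5 (λ P Q x y μ →
    (P :* ((x :- μ) :* (x :- μ)) :+ Q :* ((y :- μ) :* (y :- μ))) :* (P :+ Q)
      := P :* Q :* ((x :- y) :* (x :- y)) :+ (μ :* (P :+ Q) :- (P :* x :+ Q :* y)) :* (μ :* (P :+ Q) :- (P :* x :+ Q :* y))) refl

*-cancelʳ-≡ : ∀ {p q r} → ¬ r ≡ 0ℚ → p * r ≡ q * r → p ≡ q
*-cancelʳ-≡ {p} {q} {r} r≢0 pr≡qr = begin
  p                ≡⟨ sym (ℚP.*-identityʳ p) ⟩
  p * 1ℚ           ≡⟨ cong (p *_) (sym (ℚP.*-inverseʳ r)) ⟩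
  p * (r * 1/ r)   ≡⟨ sym (ℚP.*-assoc p r (1/ r)) ⟩
  p * r * 1/ r     ≡⟨ cong (_* 1/ r) pr≡qr ⟩
  q * r * 1/ r     ≡⟨ ℚP.*-assoc q r (1/ r) ⟩
  q * (r * 1/ r)   ≡⟨ cong (q *_) (ℚP.*-inverseʳ r) ⟩
  q * 1ℚ           ≡⟨ ℚP.*-identityʳ q ⟩
  q                ∎
  where
  open ≡-Reasoning
  instance _ = ℚ.≢-nonZero r≢0

m/n*n≡m : ∀ m d → ((+ m) / suc d) * ℕtoℚ (suc d) ≡ ℕtoℚ m
m/n*n≡m m d = ℚP.toℚᵘ-injective (begin
  toℚᵘ ((+ m) / suc d * ℕtoℚ (suc d))              ≈⟨ ℚP.toℚᵘ-homo-* ((+ m) / suc d) (ℕtoℚ (suc d)) ⟩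
  toℚᵘ ((+ m) / suc d) ℚᵘ.* toℚᵘ (ℕtoℚ (suc d))   ≈⟨ ℚᵘP.*-cong (ℚP.toℚᵘ-fromℚᵘ (mkℚᵘ (+ m) d)) (toℚᵘ-ℕtoℚ (suc d)) ⟩
  mkℚᵘ (+ m) d ℚᵘ.* mkℚᵘ (+ suc d) 0                ≈⟨ *≡* (trans (ℤP.*-identityʳ _) (cong (λ z → + m ℤ.* + z) (sym (ℕP.*-identityʳ (suc d))))) ⟩
  mkℚᵘ (+ m) 0                                       ≈⟨ toℚᵘ-ℕtoℚ m ⟨
  toℚᵘ (ℕtoℚ m)                                      ∎)
  where open ℚᵘP.≃-Reasoning

archimedean : ∀ {ε} → 0ℚ < ε → ∀ c → ∃[ N ] (∀ x → N ≤ x → ℕtoℚ c < ε * ℕtoℚ x)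
archimedean {mkℚ +[1+ p ] d _} _ c = suc (c ℕ.* suc d) , c<εx
  where
  ε : ℚ
  ε = mkℚ +[1+ p ] d _
  c<εx : ∀ x → suc (c ℕ.* suc d) ≤ x → ℕtoℚ c < ε * ℕtoℚ x
  c<εx x N≤x = ℚP.toℚᵘ-cancel-< (begin-strict
    toℚᵘ (ℕtoℚ c)                      ≃⟨ toℚᵘ-ℕtoℚ c ⟩
    mkℚᵘ (+ c) 0                        <⟨ *<* (subst₂ ℤ._<_ lhs rhs (ℤ.+<+ cd<px)) ⟩
    mkℚᵘ +[1+ p ] d ℚᵘ.* mkℚᵘ (+ x) 0   ≃⟨ ℚᵘP.*-congˡ {toℚᵘ ε} (toℚᵘ-ℕtoℚ x) ⟨
    toℚᵘ ε ℚᵘ.* toℚᵘ (ℕtoℚ x)          ≃⟨ ℚP.toℚᵘ-homo-* ε (ℕtoℚ x) ⟨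
    toℚᵘ (ε * ℕtoℚ x)                  ∎)
    where
    open ℚᵘP.≤-Reasoning
    cd<px : c ℕ.* suc (d ℕ.* 1) ℕ.< suc p ℕ.* x
    cd<px = subst (λ e → c ℕ.* suc e ℕ.< suc p ℕ.* x) (sym (ℕP.*-identityʳ d))
                  (ℕP.<-≤-trans N≤x (ℕP.m≤n*m x (suc p)))
    lhs : + (c ℕ.* suc (d ℕ.* 1)) ≡ + c ℤ.* + suc (d ℕ.* 1)
    lhs = ℤP.pos-* c (suc (d ℕ.* 1))
    rhs : + (suc p ℕ.* x) ≡ +[1+ p ] ℤ.* + x ℤ.* + 1
    rhs = trans (ℤP.pos-* (suc p) x) (sym (ℤP.*-identityʳ _))
archimedean {mkℚ (+ 0) _ _} (ℚ.*<* (ℤ.+<+ ()))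
archimedean {mkℚ -[1+ _ ] _ _} (ℚ.*<* ())

∣∣<-by-scaling : ∀ {x ε} z r → x * ℕtoℚ z ≡ ℕtoℚ r → ℕtoℚ r < ε * ℕtoℚ z → ∣ x ∣ < ε
∣∣<-by-scaling {ε = ε} zero r _ r<ε*0 = contradiction (ℚP.≤-<-trans 0≤r r<0) (ℚP.<-irrefl refl)
  where
  0≤r : 0ℚ ℚ.≤ ℕtoℚ r
  0≤r = ℚP.nonNegative⁻¹ (ℕtoℚ r) {{ℚP.normalize-nonNeg r 1}}
  r<0 : ℕtoℚ r < 0ℚ
  r<0 = subst (ℕtoℚ r <_) (ℚP.*-zeroʳ ε) r<ε*0
∣∣<-by-scaling {x} {ε} (suc z) r xz≡r r<εz = subst (_< ε) (sym (ℚP.0≤p⇒∣p∣≡p 0≤x)) x<ε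
  where
  instance
    z-pos : ℚ.Positive (ℕtoℚ (suc z))
    z-pos = ℕtoℚ-pos (suc z)
    z-nonNeg : ℚ.NonNegative (ℕtoℚ (suc z))
    z-nonNeg = ℚP.normalize-nonNeg (suc z) 1
  0≤x : 0ℚ ℚ.≤ x
  0≤x = ℚP.*-cancelʳ-≤-pos (ℕtoℚ (suc z))
          (subst₂ ℚ._≤_ (sym (ℚP.*-zeroˡ (ℕtoℚ (suc z)))) (sym xz≡r)
                  (ℚP.nonNegative⁻¹ (ℕtoℚ r) {{ℚP.normalize-nonNeg r 1}}))
  x<ε : x < ε
  x<ε = ℚP.*-cancelʳ-<-nonNeg (ℕtoℚ (suc z)) (subst (_< ε * ℕtoℚ (suc z)) (sym xz≡r) r<εz)

-- With K B = A T + E, the gap K³B² − K A²T² = K((A T + E)² − (A T)²) factors through E.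
limit-gap : ∀ c ℓ K A B T E D → c * (B * B) ≡ K * (A * A) → ℓ * D ≡ K * (K * K) → D ≡ T * T →
  K * B ≡ A * T + E → (ℓ - c) * (B * B * D) ≡ K * E * (K * B + A * T)
limit-gap c ℓ K A B T E D cB²≡KA² ℓD≡K³ D≡T² KB≡AT+E = begin
  (ℓ - c) * (B * B * D)                             ≡⟨ expand ℓ c B D ⟩
  ℓ * D * (B * B) - c * (B * B) * D                 ≡⟨ cong₂ (λ u w → u * (B * B) - w * D) ℓD≡K³ cB²≡KA² ⟩
  K * (K * K) * (B * B) - K * (A * A) * D           ≡⟨ cong (λ w → K * (K * K) * (B * B) - K * (A * A) * w) D≡T² ⟩
  K * (K * K) * (B * B) - K * (A * A) * (T * T)     ≡⟨ regroup K A B T ⟩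
  K * ((K * B) * (K * B)) - K * ((A * T) * (A * T)) ≡⟨ cong (λ w → K * (w * w) - K * ((A * T) * (A * T))) KB≡AT+E ⟩
  K * ((A * T + E) * (A * T + E)) - K * ((A * T) * (A * T)) ≡⟨ factor K (A * T) E ⟩
  K * E * ((A * T + E) + A * T)                     ≡⟨ cong (λ w → K * E * (w + A * T)) (sym KB≡AT+E) ⟩
  K * E * (K * B + A * T)                           ∎
  where
  open ≡-Reasoning
  expand : ∀ ℓ c B D → (ℓ - c) * (B * B * D) ≡ ℓ * D * (B * B) - c * (B * B) * D
  expand = solve 4 (λ ℓ c B D → (ℓ :- c) :* (B :* B :* D) := ℓ :* D :* (B :* B) :- c :* (B :* B) :* D) refl
  regroup : ∀ K A B T → K * (K * K) * (B * B) - K * (A * A) * (T * T) ≡ K * ((K * B) * (K * B)) - K * ((A * T) * (A * T))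
  regroup = solve 4 (λ K A B T → K :* (K :* K) :* (B :* B) :- K :* (A :* A) :* (T :* T)
                                 := K :* ((K :* B) :* (K :* B)) :- K :* ((A :* T) :* (A :* T))) refl
  factor : ∀ K u E → K * ((u + E) * (u + E)) - K * (u * u) ≡ K * E * ((u + E) + u)
  factor = solve 3 (λ K u E → K :* ((u :+ E) :* (u :+ E)) :- K :* (u :* u) := K :* E :* ((u :+ E) :+ u)) refl

module _ (k' : ℕ) where

  k t D : ℕ
  k = suc k'
  t = suc (2 ℕ.* k)
  D = t ^ 2

  K T E : ℚ
  K = ℕtoℚ k
  T = ℕtoℚ t
  E = ℕtoℚ (suc k)

  limit : ℚ
  limit = (+ (k ^ 3)) / D

  limit*D : limit * ℕtoℚ D ≡ K * (K * K)
  limit*D = begin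
    limit * ℕtoℚ D                    ≡⟨ m/n*n≡m (k ^ 3) _ ⟩
    ℕtoℚ (k ℕ.* (k ℕ.* (k ℕ.* 1)))    ≡⟨ cong (λ z → ℕtoℚ (k ℕ.* (k ℕ.* z))) (ℕP.*-identityʳ k) ⟩
    ℕtoℚ (k ℕ.* (k ℕ.* k))            ≡⟨ ℕtoℚ-* k (k ℕ.* k) ⟩
    K * ℕtoℚ (k ℕ.* k)                ≡⟨ cong (K *_) (ℕtoℚ-* k k) ⟩
    K * (K * K)                       ∎
    where open ≡-Reasoning

  D≡T*T : ℕtoℚ D ≡ T * T
  D≡T*T = trans (cong (λ z → ℕtoℚ (t ℕ.* z)) (ℕP.*-identityʳ t)) (ℕtoℚ-* t t)

  gapBound : ℕ
  gapBound = k ℕ.* suc k ℕ.* (2 ℕ.* k)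

  module _ (n' : ℕ) where

    -- a = kn − 1 and b = (2k+1)n − 1, written without truncated subtraction.
    n m a b : ℕ
    n = suc n'
    m = k ℕ.* n
    a = k' ℕ.+ n' ℕ.* k
    b = 2 ℕ.* k ℕ.* n ℕ.+ n'

    P A B : ℚ
    P = ℕtoℚ n
    A = ℕtoℚ a
    B = ℕtoℚ b

    cliqueDegree≡ : n' ℕ.+ m ≡ a ℕ.+ n
    cliqueDegree≡ = identity k' n'
      where
      identity : ∀ k' n' → n' ℕ.+ suc k' ℕ.* suc n' ≡ k' ℕ.+ n' ℕ.* suc k' ℕ.+ suc n'
      identity = solve-∀

    degreeSum≡ : n ℕ.* (n' ℕ.+ m) ℕ.+ m ℕ.* n ≡ n ℕ.* b
    degreeSum≡ = identity k' n'
      where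
      identity : ∀ k' n' → suc n' ℕ.* (n' ℕ.+ suc k' ℕ.* suc n') ℕ.+ suc k' ℕ.* suc n' ℕ.* suc n'
                           ≡ suc n' ℕ.* (2 ℕ.* suc k' ℕ.* suc n' ℕ.+ n')
      identity = solve-∀

    k*b≡a*t+k+1 : k ℕ.* b ≡ a ℕ.* t ℕ.+ suc k
    k*b≡a*t+k+1 = identity k' n'
      where
      identity : ∀ k' n' → suc k' ℕ.* (2 ℕ.* suc k' ℕ.* suc n' ℕ.+ n')
                           ≡ (k' ℕ.+ n' ℕ.* suc k') ℕ.* suc (2 ℕ.* suc k') ℕ.+ suc (suc k')
      identity = solve-∀

    splitDegreesℚ≡ : map ℕtoℚ (splitDegrees n m) ≡ replicate n (ℕtoℚ (n' ℕ.+ m)) ++ replicate m P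
    splitDegreesℚ≡ = begin
      map ℕtoℚ (splitDegrees n m)                                   ≡⟨ cong (map ℕtoℚ) (splitDegrees-twoValued n' m) ⟩
      map ℕtoℚ (replicate n (n' ℕ.+ m) ++ replicate m n)            ≡⟨ map-++ ℕtoℚ (replicate n (n' ℕ.+ m)) (replicate m n) ⟩
      map ℕtoℚ (replicate n (n' ℕ.+ m)) ++ map ℕtoℚ (replicate m n) ≡⟨ cong₂ _++_ (map-replicate ℕtoℚ n (n' ℕ.+ m))
                                                                                   (map-replicate ℕtoℚ m n) ⟩
      replicate n (ℕtoℚ (n' ℕ.+ m)) ++ replicate m P                ∎
      where open ≡-Reasoning

    cdSplit*B² : cdSplit n m * (B * B) ≡ K * (A * A)
    cdSplit*B² = *-cancelʳ-≡ (ℕtoℚ-≢0 (n ℕ.* n)) (begin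
      cdSplit n m * (B * B) * ℕtoℚ (n ℕ.* n)         ≡⟨ cong (cdSplit n m * (B * B) *_) (ℕtoℚ-* n n) ⟩
      cdSplit n m * (B * B) * (P * P)                ≡⟨ regroupˡ (cdSplit n m) B P ⟩
      cdSplit n m * ((P * B) * (P * B))              ≡⟨ cong (λ s → cdSplit n m * (s * s)) S≡P*B ⟨
      cv (map ℕtoℚ (splitDegrees n m)) * (S * S)     ≡⟨ cong (λ v → cv v * (S * S)) splitDegreesℚ≡ ⟩
      cv (replicate n X ++ replicate m P) * (S * S)  ≡⟨ cv-twoValued n m X P S≢0 ⟩
      P * Q * ((X - P) * (X - P))                    ≡⟨ cong₂ (λ q d → P * q * (d * d)) (ℕtoℚ-* k n) X-P≡A ⟩
      P * (K * P) * (A * A)                          ≡⟨ regroupʳ K A P ⟩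
      K * (A * A) * (P * P)                          ≡⟨ cong (K * (A * A) *_) (ℕtoℚ-* n n) ⟨
      K * (A * A) * ℕtoℚ (n ℕ.* n)                   ∎)
      where
      open ≡-Reasoning
      X Q S : ℚ
      X = ℕtoℚ (n' ℕ.+ m)
      Q = ℕtoℚ m
      S = P * X + Q * P
      S≡P*B : S ≡ P * B
      S≡P*B = begin
        P * X + Q * P                                  ≡⟨ cong₂ _+_ (ℕtoℚ-* n (n' ℕ.+ m)) (ℕtoℚ-* m n) ⟨
        ℕtoℚ (n ℕ.* (n' ℕ.+ m)) + ℕtoℚ (m ℕ.* n)       ≡⟨ ℕtoℚ-+ (n ℕ.* (n' ℕ.+ m)) (m ℕ.* n) ⟨
        ℕtoℚ (n ℕ.* (n' ℕ.+ m) ℕ.+ m ℕ.* n)            ≡⟨ cong ℕtoℚ degreeSum≡ ⟩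
        ℕtoℚ (n ℕ.* b)                                 ≡⟨ ℕtoℚ-* n b ⟩
        P * B                                          ∎
      S≢0 : ¬ S ≡ 0ℚ
      S≢0 S≡0 = ℕtoℚ-≢0 (n ℕ.* b) (trans (ℕtoℚ-* n b) (trans (sym S≡P*B) S≡0))
      X-P≡A : X - P ≡ A
      X-P≡A = trans (cong (_- P) (trans (cong ℕtoℚ cliqueDegree≡) (ℕtoℚ-+ a n))) (cancel A P)
        where
        cancel : ∀ A P → A + P - P ≡ A
        cancel = solve 2 (λ A P → A :+ P :- P := A) refl
      regroupˡ : ∀ c B P → c * (B * B) * (P * P) ≡ c * ((P * B) * (P * B))
      regroupˡ = solve 3 (λ c B P → c :* (B :* B) :* (P :* P) := c :* ((P :* B) :* (P :* B))) refl
      regroupʳ : ∀ K A P → P * (K * P) * (A * A) ≡ K * (A * A) * (P * P)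
      regroupʳ = solve 3 (λ K A P → P :* (K :* P) :* (A :* A) := K :* (A :* A) :* (P :* P)) refl

    K*B≡A*T+E : K * B ≡ A * T + E
    K*B≡A*T+E = begin
      K * B                      ≡⟨ ℕtoℚ-* k b ⟨
      ℕtoℚ (k ℕ.* b)             ≡⟨ cong ℕtoℚ k*b≡a*t+k+1 ⟩
      ℕtoℚ (a ℕ.* t ℕ.+ suc k)   ≡⟨ ℕtoℚ-+ (a ℕ.* t) (suc k) ⟩
      ℕtoℚ (a ℕ.* t) + E         ≡⟨ cong (_+ E) (ℕtoℚ-* a t) ⟩
      A * T + E                  ∎
      where open ≡-Reasoning

    gap : ℕ
    gap = k ℕ.* suc k ℕ.* (k ℕ.* b ℕ.+ a ℕ.* t)

    limit-cdSplit≡ : (limit - cdSplit n m) * ℕtoℚ (b ℕ.* D ℕ.* b) ≡ ℕtoℚ gap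
    limit-cdSplit≡ = begin
      (limit - cdSplit n m) * ℕtoℚ (b ℕ.* D ℕ.* b)  ≡⟨ cong ((limit - cdSplit n m) *_) scale≡ ⟩
      (limit - cdSplit n m) * (B * B * ℕtoℚ D)      ≡⟨ limit-gap (cdSplit n m) limit K A B T E (ℕtoℚ D) cdSplit*B² limit*D D≡T*T K*B≡A*T+E ⟩
      K * E * (K * B + A * T)                       ≡⟨ gap≡ ⟨
      ℕtoℚ gap                                      ∎
      where
      open ≡-Reasoning
      scale≡ : ℕtoℚ (b ℕ.* D ℕ.* b) ≡ B * B * ℕtoℚ D
      scale≡ = trans (ℕtoℚ-* (b ℕ.* D) b)
               (trans (cong (_* B) (ℕtoℚ-* b D)) (regroup B (ℕtoℚ D)))
        where
        regroup : ∀ B D → B * D * B ≡ B * B * D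
        regroup = solve 2 (λ B D → B :* D :* B := B :* B :* D) refl
      gap≡ : ℕtoℚ gap ≡ K * E * (K * B + A * T)
      gap≡ = trans (ℕtoℚ-* (k ℕ.* suc k) (k ℕ.* b ℕ.+ a ℕ.* t))
             (cong₂ _*_ (ℕtoℚ-* k (suc k))
                        (trans (ℕtoℚ-+ (k ℕ.* b) (a ℕ.* t)) (cong₂ _+_ (ℕtoℚ-* k b) (ℕtoℚ-* a t))))

    gap≤gapBound*b : gap ≤ gapBound ℕ.* b
    gap≤gapBound*b = ℕP.≤-trans (ℕP.*-monoʳ-≤ (k ℕ.* suc k) (ℕP.+-monoʳ-≤ (k ℕ.* b) a*t≤k*b))
                                (ℕP.≤-reflexive (identity k b))
      where
      a*t≤k*b : a ℕ.* t ≤ k ℕ.* b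
      a*t≤k*b = subst (a ℕ.* t ≤_) (sym k*b≡a*t+k+1) (ℕP.m≤m+n (a ℕ.* t) (suc k))
      identity : ∀ k b → k ℕ.* suc k ℕ.* (k ℕ.* b ℕ.+ k ℕ.* b) ≡ k ℕ.* suc k ℕ.* (2 ℕ.* k) ℕ.* b
      identity = solve-∀

    n≤b*D : n ≤ b ℕ.* D
    n≤b*D = ℕP.≤-trans (ℕP.≤-trans (ℕP.m≤n*m n (2 ℕ.* k)) (ℕP.m≤m+n (2 ℕ.* k ℕ.* n) n'))
                       (ℕP.m≤m*n b D)

    cdSplit-near-limit : ∀ {ε} → ℕtoℚ gapBound < ε * ℕtoℚ (b ℕ.* D) → ∣ cdSplit n m - limit ∣ < ε
    cdSplit-near-limit {ε} bound<ε*b*D =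
      subst (_< ε) ∣limit-cdSplit∣≡ (∣∣<-by-scaling (b ℕ.* D ℕ.* b) gap limit-cdSplit≡ gap<ε*scale)
      where
      gap<ε*scale : ℕtoℚ gap < ε * ℕtoℚ (b ℕ.* D ℕ.* b)
      gap<ε*scale = begin-strict
        ℕtoℚ gap                        ≤⟨ ℕtoℚ-mono-≤ gap≤gapBound*b ⟩
        ℕtoℚ (gapBound ℕ.* b)           ≡⟨ ℕtoℚ-* gapBound b ⟩
        ℕtoℚ gapBound * B               <⟨ ℚP.*-monoˡ-<-pos B {{ℕtoℚ-pos b}} bound<ε*b*D ⟩
        ε * ℕtoℚ (b ℕ.* D) * B          ≡⟨ ℚP.*-assoc ε (ℕtoℚ (b ℕ.* D)) B ⟩
        ε * (ℕtoℚ (b ℕ.* D) * B)        ≡⟨ cong (ε *_) (ℕtoℚ-* (b ℕ.* D) b) ⟨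
        ε * ℕtoℚ (b ℕ.* D ℕ.* b)        ∎
        where open ℚP.≤-Reasoning
      ∣limit-cdSplit∣≡ : ∣ limit - cdSplit n m ∣ ≡ ∣ cdSplit n m - limit ∣
      ∣limit-cdSplit∣≡ = trans (sym (ℚP.∣-p∣≡∣p∣ (limit - cdSplit n m)))
                               (cong ∣_∣ (negate limit (cdSplit n m)))
        where
        negate : ∀ x y → - (x - y) ≡ y - x
        negate = solve 2 (λ x y → :- (x :- y) := y :- x) refl

mainTheorem11 : (k : ℕ) → 1 ≤ k →
    ∀ (ε : ℚ) → 0ℚ < ε →
    ∃[ N ] (∀ (n : ℕ) → N ≤ n →
    ∣ cdSplit n (k ℕ.* n) - ((+ (k ^ 3)) / (suc (2 ℕ.* k) ^ 2)) ∣ < ε)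
mainTheorem11 (suc k') _ ε 0<ε =
  let N , bound<ε*x = archimedean 0<ε (gapBound k')
      near : ∀ n → suc N ≤ n → ∣ cdSplit n (suc k' ℕ.* n) - limit k' ∣ < ε
      near = λ { (suc n') N<n → cdSplit-near-limit k' n'
                   (bound<ε*x (b k' n' ℕ.* D k') (ℕP.≤-trans (ℕP.<⇒≤ N<n) (n≤b*D k' n'))) }
  in suc N , near
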